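{- A permutation $\sigma$ of $[n]$ is a Baxter permutation if and only if (viewed as the $2$-permutation $(\sigma)$) it is well-sliced.
   Context: A permutation $\sigma$ of $[n]$ is Baxter if there are no indices $i_1<i_2<i_2+1<i_4$ (writing $i_3=i_2+1$) such that $\sigma(i_1)\sigma(i_2)\sigma(i_3)\sigma(i_4)$ is order-isomorphic to $2413$ or to $3142$. For a $d$-permutation (here $d=2$) with diagram $P\subset[n]^d$ (one point on each hyperplane $x_k=j$): two points $p,q\in P$ are $k$-adjacent if their $k$-th coordinates differ by exactly one; the slice of such a pair is the closed axis-parallel box with opposite corners $p$ and $q$, and it is of type $k$ for every $k$ such that $p,q$ are $k$-adjacent (a slice may have several types). The direction of a slice with corners $p,q$, where $p_1<q_1$, is the sign vector of $q-p$. Two slices intersect if their intersection has nonempty interior. The $d$-permutation is well-sliced if every slice intersects exactly one slice of each type $k\in[d]$, and any two intersecting slices have the same direction. -}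

module Defs where

open import Data.Nat using (ℕ; suc; _<_; ∣_-_∣; _⊓_; _⊔_)
open import Data.Fin using (Fin; toℕ; zero; suc)
open import Data.Fin.Permutation using (Permutation′; _⟨$⟩ʳ_)
open import Data.Integer using (_⊖_; sign)
open import Data.Sign using (Sign)
open import Data.Product using (Σ; ∃; ∃-syntax; _×_; _,_)
open import Relation.Binary.PropositionalEquality using (_≡_)
open import Relation.Nullary using (¬_)

module _ {n : ℕ} (σ : Permutation′ n) where

  -- σ(i) as a natural number (0-based positions/values; only order matters)
  val : Fin n → ℕ
  val i = toℕ (σ ⟨$⟩ʳ i)

  Pattern2413 : Fin n → Fin n → Fin n → Fin n → Set
  Pattern2413 i₁ i₂ i₃ i₄ = val i₃ < val i₁ × val i₁ < val i₄ × val i₄ < val i₂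

  Pattern3142 : Fin n → Fin n → Fin n → Fin n → Set
  Pattern3142 i₁ i₂ i₃ i₄ = val i₂ < val i₄ × val i₄ < val i₁ × val i₁ < val i₃

  Baxter : Set
  Baxter = ∀ (i₁ i₂ i₃ i₄ : Fin n) →
    toℕ i₁ < toℕ i₂ → toℕ i₃ ≡ suc (toℕ i₂) → toℕ i₃ < toℕ i₄ →
    ¬ (Pattern2413 i₁ i₂ i₃ i₄) × ¬ (Pattern3142 i₁ i₂ i₃ i₄)

  -- The diagram of the 2-permutation (σ) is P = { (i , σ i) }; the point with
  -- first coordinate i is identified with its index i.
  -- k-th coordinate of the point with index i (k = 0 is the first coordinate,
  -- k = 1 the second).
  coord : Fin 2 → Fin n → ℕ
  coord zero     i = toℕ i
  coord (suc _)  i = val i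

  Adjacent : Fin 2 → Fin n → Fin n → Set
  Adjacent k i j = ∣ coord k i - coord k j ∣ ≡ 1

  -- A slice: a pair of points p, q (with p₁ < q₁) that are k-adjacent for
  -- some k; it is the closed box with opposite corners p and q.
  record Slice : Set where
    constructor slice
    field
      lo hi   : Fin n
      lo<hi   : toℕ lo < toℕ hi
      adj     : ∃[ k ] Adjacent k lo hi

  open Slice public

  HasType : Fin 2 → Slice → Set
  HasType k s = Adjacent k (lo s) (hi s)

  SameSlice : Slice → Slice → Set
  SameSlice s t = lo s ≡ lo t × hi s ≡ hi t

  low high : Fin 2 → Slice → ℕ
  low  k s = coord k (lo s) ⊓ coord k (hi s)
  high k s = coord k (lo s) ⊔ coord k (hi s)

  -- The interior of the intersection of two boxes is the product of the
  -- intersections of the open intervals (low, high); it is nonempty iff each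
  -- of these is nonempty, i.e. max of lows < min of highs, i.e. the
  -- following holds in every coordinate.
  OverlapOn : Fin 2 → Slice → Slice → Set
  OverlapOn k s t = low k s < high k t × low k t < high k s

  Intersect : Slice → Slice → Set
  Intersect s t = ∀ k → OverlapOn k s t

  direction : Slice → Fin 2 → Sign
  direction s k = sign (coord k (hi s) ⊖ coord k (lo s))

  WellSliced : Set
  WellSliced =
    (∀ (s : Slice) (k : Fin 2) → ∃[ t ] (HasType k t × Intersect s t ×
        (∀ (t′ : Slice) → HasType k t′ → Intersect s t′ → SameSlice t′ t)))
    × (∀ (s t : Slice) → Intersect s t → ∀ k → direction s k ≡ direction t k)

-- Let s be a slice of type j with corners ℓ, u, ordered so that ℓ comes first in the other
-- coordinate k. The type-k slices meeting s are exactly the k-adjacent pairs whose k-coordinates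
-- lie between those of ℓ and u and which sit on opposite sides of the j-cut between ℓ and u.
-- Walking along coordinate k from ℓ to u one must cross that cut, so such a pair always exists,
-- and it has the direction of s when its point on ℓ's side comes first. It is the only one
-- precisely when there is no inversion: no point on ℓ's side above a point on u's side strictly
-- inside the band. For j = 0 an inversion is literally a 2413 or 3142 occurrence around the
-- adjacent positions of s. For j = 1, walking along the positions between the inverted pair
-- crosses the value cut at two adjacent positions, which together with ℓ and u form such an
-- occurrence. Conversely an inversion, walked through backwards, yields a second type-k slice
-- meeting s.

module Submission where

open import Defs
open import Data.Bool using (Bool; true; false)
open import Data.Bool.Properties using (¬-not) renaming (_≟_ to _≟ᵇ_)
open import Data.Empty using (⊥; ⊥-elim)
open import Data.Fin using (Fin; toℕ; fromℕ<; zero; suc)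
open import Data.Fin.Permutation using (Permutation′; _⟨$⟩ʳ_; _⟨$⟩ˡ_; inverseˡ; inverseʳ)
open import Data.Fin.Properties using (toℕ-injective; toℕ-fromℕ<; toℕ<n; any?)
open import Data.Integer using (_⊖_; sign)
open import Data.Integer.Properties using (⊖-≥; sign-⊖-<)
open import Data.Nat using (ℕ; zero; suc; _≤_; _<_; _≤?_; _≟_; s≤s; s≤s⁻¹; ∣_-_∣; _⊓_; _⊔_)
open import Data.Nat.Properties
open import Data.Product using (∃-syntax; ∃₂; _×_; _,_; proj₁; proj₂)
open import Data.Sign using (Sign; opposite; _*_)
open import Data.Sum using (_⊎_; inj₁; inj₂)
open import Function using (id; _∘_; _$_; case_of_)
open import Function.Bundles using (_⇔_; mk⇔; Equivalence)
open import Function.Properties.Equivalence using () renaming (trans to ⇔-trans; sym to ⇔-sym)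
open import Relation.Binary.Definitions using (tri<; tri≈; tri>)
open import Relation.Binary.PropositionalEquality
open import Relation.Nullary using (¬_; yes; no; does; contradiction; ¬?; _×-dec_)
open import Relation.Nullary.Decidable using (dec-true; dec-false; decidable-stable)
open import Relation.Unary using (Decidable)

switch-between : ∀ {P : ℕ → Set} → Decidable P → ∀ {m m′} → m ≤ m′ → P m → ¬ P m′ →
                 ∃[ c ] (m ≤ c × suc c ≤ m′ × P c × ¬ P (suc c))
switch-between {P} P? {m′ = zero} m≤0 Pm ¬P0 = contradiction (subst P (n≤0⇒n≡0 m≤0) Pm) ¬P0
switch-between P? {m′ = suc m′} m≤1+m′ Pm ¬P1+m′ with m≤n⇒m<n∨m≡n m≤1+m′
... | inj₂ refl = contradiction Pm ¬P1+m′
... | inj₁ m<1+m′ with P? m′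
...   | yes Pm′ = m′ , s≤s⁻¹ m<1+m′ , ≤-refl , Pm′ , ¬P1+m′
...   | no ¬Pm′ =
  let c , m≤c , c<m′ , Pc , ¬P1+c = switch-between P? (s≤s⁻¹ m<1+m′) Pm ¬Pm′
  in  c , m≤c , m≤n⇒m≤1+n c<m′ , Pc , ¬P1+c

∣n-1+n∣≡1 : ∀ n → ∣ n - suc n ∣ ≡ 1
∣n-1+n∣≡1 zero    = refl
∣n-1+n∣≡1 (suc n) = ∣n-1+n∣≡1 n

∣m-n∣≡1⇒n≡1+m⊎m≡1+n : ∀ m n → ∣ m - n ∣ ≡ 1 → n ≡ suc m ⊎ m ≡ suc n
∣m-n∣≡1⇒n≡1+m⊎m≡1+n zero    (suc n) eq = inj₁ (cong suc (suc-injective eq))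
∣m-n∣≡1⇒n≡1+m⊎m≡1+n (suc m) zero    eq = inj₂ (cong suc (suc-injective eq))
∣m-n∣≡1⇒n≡1+m⊎m≡1+n (suc m) (suc n) eq with ∣m-n∣≡1⇒n≡1+m⊎m≡1+n m n eq
... | inj₁ n≡1+m = inj₁ (cong suc n≡1+m)
... | inj₂ m≡1+n = inj₂ (cong suc m≡1+n)

m<n∧∣m-n∣≡1⇒n≡1+m : ∀ {m n} → m < n → ∣ m - n ∣ ≡ 1 → n ≡ suc m
m<n∧∣m-n∣≡1⇒n≡1+m {m} {n} m<n eq with ∣m-n∣≡1⇒n≡1+m⊎m≡1+n m n eq
... | inj₁ n≡1+m = n≡1+m
... | inj₂ refl  = contradiction m<n (<⇒≯ (n<1+n n))

adjacent-straddle : ∀ {l h c x y} → l ≤ c → c < h → h ≡ suc l → x ≤ c → c < y → x ≤ l × h ≤ y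
adjacent-straddle {y = y} l≤c c<h h≡1+l x≤c c<y =
  ≤-trans x≤c (s≤s⁻¹ (subst (_ <_) h≡1+l c<h)) , subst (_≤ y) (sym h≡1+l) (≤-<-trans l≤c c<y)

∣m-n∣≡1⇒m⊔n≡1+m⊓n : ∀ {m n} → ∣ m - n ∣ ≡ 1 → m ⊔ n ≡ suc (m ⊓ n)
∣m-n∣≡1⇒m⊔n≡1+m⊓n {m} {n} eq with ∣m-n∣≡1⇒n≡1+m⊎m≡1+n m n eq
... | inj₁ refl = trans (m≤n⇒m⊔n≡n (n≤1+n m)) (cong suc (sym (m≤n⇒m⊓n≡m (n≤1+n m))))
... | inj₂ refl = trans (m≥n⇒m⊔n≡m (n≤1+n n)) (cong suc (sym (m≥n⇒m⊓n≡n (n≤1+n n))))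

m≢n⇒m⊓n<m⊔n : ∀ {m n} → m ≢ n → m ⊓ n < m ⊔ n
m≢n⇒m⊓n<m⊔n {m} {n} m≢n with <-cmp m n
... | tri< m<n _ _ = subst₂ _<_ (sym (m≤n⇒m⊓n≡m (<⇒≤ m<n))) (sym (m≤n⇒m⊔n≡n (<⇒≤ m<n))) m<n
... | tri≈ _ m≡n _ = contradiction m≡n m≢n
... | tri> _ _ n<m = subst₂ _<_ (sym (m≥n⇒m⊓n≡n (<⇒≤ n<m))) (sym (m≥n⇒m⊔n≡m (<⇒≤ n<m))) n<m

straddle⇔ : ∀ {a b c} → (c < a ⊔ b × a ⊓ b < suc c) ⇔ ((a ≤ c × c < b) ⊎ (b ≤ c × c < a))
straddle⇔ {a} {b} {c} = mk⇔ to from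
  where
  to : c < a ⊔ b × a ⊓ b < suc c → (a ≤ c × c < b) ⊎ (b ≤ c × c < a)
  to (c<a⊔b , a⊓b≤c) with ≤-total a b
  ... | inj₁ a≤b = inj₁ (s≤s⁻¹ (subst (_< suc c) (m≤n⇒m⊓n≡m a≤b) a⊓b≤c) , subst (c <_) (m≤n⇒m⊔n≡n a≤b) c<a⊔b)
  ... | inj₂ b≤a = inj₂ (s≤s⁻¹ (subst (_< suc c) (m≥n⇒m⊓n≡n b≤a) a⊓b≤c) , subst (c <_) (m≥n⇒m⊔n≡m b≤a) c<a⊔b)
  from : (a ≤ c × c < b) ⊎ (b ≤ c × c < a) → c < a ⊔ b × a ⊓ b < suc c
  from (inj₁ (a≤c , c<b)) = <-≤-trans c<b (m≤n⊔m a b) , s≤s (≤-trans (m⊓n≤m a b) a≤c)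
  from (inj₂ (b≤c , c<a)) = <-≤-trans c<a (m≤m⊔n a b) , s≤s (≤-trans (m⊓n≤n a b) b≤c)

unit-overlap⇔ : ∀ {a b l h} → ∣ a - b ∣ ≡ 1 →
                (l < a ⊔ b × a ⊓ b < h) ⇔ ((l ≤ a × a ≤ h) × (l ≤ b × b ≤ h))
unit-overlap⇔ {a} {b} {l} {h} adj = mk⇔ to from
  where
  ⊔≡ : a ⊔ b ≡ suc (a ⊓ b)
  ⊔≡ = ∣m-n∣≡1⇒m⊔n≡1+m⊓n adj
  to : l < a ⊔ b × a ⊓ b < h → (l ≤ a × a ≤ h) × (l ≤ b × b ≤ h)
  to (l<a⊔b , a⊓b<h) =
    (≤-trans l≤a⊓b (m⊓n≤m a b) , ≤-trans (m≤m⊔n a b) a⊔b≤h) ,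
    (≤-trans l≤a⊓b (m⊓n≤n a b) , ≤-trans (m≤n⊔m a b) a⊔b≤h)
    where
    l≤a⊓b : l ≤ a ⊓ b
    l≤a⊓b = s≤s⁻¹ (subst (l <_) ⊔≡ l<a⊔b)
    a⊔b≤h : a ⊔ b ≤ h
    a⊔b≤h = subst (_≤ h) (sym ⊔≡) a⊓b<h
  from : (l ≤ a × a ≤ h) × (l ≤ b × b ≤ h) → l < a ⊔ b × a ⊓ b < h
  from ((l≤a , a≤h) , (l≤b , b≤h)) =
    subst (l <_) (sym ⊔≡) (s≤s (⊓-glb l≤a l≤b)) , subst (_≤ h) ⊔≡ (⊔-lub a≤h b≤h)

other : Fin 2 → Fin 2
other zero       = suc zero
other (suc zero) = zero

this-or-other : ∀ j k → k ≡ j ⊎ k ≡ other j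
this-or-other zero       zero       = inj₁ refl
this-or-other zero       (suc zero) = inj₂ refl
this-or-other (suc zero) zero       = inj₂ refl
this-or-other (suc zero) (suc zero) = inj₁ refl

module _ {n : ℕ} (σ : Permutation′ n) where

  coord-injective : ∀ k {p q} → coord σ k p ≡ coord σ k q → p ≡ q
  coord-injective zero       = toℕ-injective
  coord-injective (suc zero) {p} {q} σp≡σq = begin
    p                  ≡⟨ inverseˡ σ ⟨
    σ ⟨$⟩ˡ (σ ⟨$⟩ʳ p)  ≡⟨ cong (σ ⟨$⟩ˡ_) (toℕ-injective σp≡σq) ⟩
    σ ⟨$⟩ˡ (σ ⟨$⟩ʳ q)  ≡⟨ inverseˡ σ ⟩
    q                  ∎
    where open ≡-Reasoning

  coord-surjective : ∀ k {c} → c < n → ∃[ p ] coord σ k p ≡ c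
  coord-surjective zero       c<n = fromℕ< c<n , toℕ-fromℕ< c<n
  coord-surjective (suc zero) c<n = σ ⟨$⟩ˡ fromℕ< c<n , trans (cong toℕ (inverseʳ σ)) (toℕ-fromℕ< c<n)

  coord<n : ∀ k p → coord σ k p < n
  coord<n zero       p = toℕ<n p
  coord<n (suc zero) p = toℕ<n (σ ⟨$⟩ʳ p)

  coord-≤∧≢⇒< : ∀ k {p q} → coord σ k p ≤ coord σ k q → p ≢ q → coord σ k p < coord σ k q
  coord-≤∧≢⇒< k p≤q p≢q = ≤∧≢⇒< p≤q (λ cp≡cq → p≢q (coord-injective k cp≡cq))

  coord-<⇒≢ : ∀ k {p q} → coord σ k p < coord σ k q → p ≢ q
  coord-<⇒≢ k p<q refl = <-irrefl refl p<q

  adjacent-irrefl : ∀ k {p} → ¬ Adjacent σ k p p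
  adjacent-irrefl k {p} adj with trans (sym (∣n-n∣≡0 (coord σ k p))) adj
  ... | ()

  adjacent-sym : ∀ k {p q} → Adjacent σ k p q → Adjacent σ k q p
  adjacent-sym k {p} {q} = trans (∣-∣-comm (coord σ k q) (coord σ k p))

  switch-along : ∀ k {L : Fin n → Set} → Decidable L → ∀ {p q} →
                 coord σ k p ≤ coord σ k q → L p → ¬ L q →
                 ∃₂ λ x y → L x × ¬ L y × coord σ k p ≤ coord σ k x × coord σ k y ≤ coord σ k q ×
                            coord σ k y ≡ suc (coord σ k x)
  switch-along k {L} L? {p} {q} p≤q Lp ¬Lq =
    let c , p≤c , c<q , (x , x≡c , Lx) , ¬Occupied1+c =
          switch-between Occupied? p≤q (p , refl , Lp) ¬Occupied-q
        y , y≡1+c = coord-surjective k (≤-<-trans c<q (coord<n k q))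
    in  x , y , Lx , (λ Ly → ¬Occupied1+c (y , y≡1+c , Ly)) ,
        subst (coord σ k p ≤_) (sym x≡c) p≤c , subst (_≤ coord σ k q) (sym y≡1+c) c<q ,
        trans y≡1+c (cong suc (sym x≡c))
    where
    Occupied : ℕ → Set
    Occupied c = ∃[ x ] (coord σ k x ≡ c × L x)
    Occupied? : Decidable Occupied
    Occupied? c = any? (λ x → (coord σ k x ≟ c) ×-dec L? x)
    ¬Occupied-q : ¬ Occupied (coord σ k q)
    ¬Occupied-q (x , x≡q , Lx) = ¬Lq (subst L (coord-injective k x≡q) Lx)

  data Joins (s : Slice σ) (p q : Fin n) : Set where
    forwards  : lo s ≡ p → hi s ≡ q → Joins s p q
    backwards : lo s ≡ q → hi s ≡ p → Joins s p q

  joins-corners : ∀ {s p q x y} → Joins s p q → Joins s x y → (x ≡ p × y ≡ q) ⊎ (x ≡ q × y ≡ p)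
  joins-corners (forwards refl refl) (forwards refl refl) = inj₁ (refl , refl)
  joins-corners (forwards refl refl) (backwards refl refl) = inj₂ (refl , refl)
  joins-corners (backwards refl refl) (forwards refl refl) = inj₂ (refl , refl)
  joins-corners (backwards refl refl) (backwards refl refl) = inj₁ (refl , refl)

  joins-unique : ∀ {s t p q} → Joins s p q → Joins t p q → SameSlice σ t s
  joins-unique     (forwards refl refl) (forwards lo≡ hi≡) = lo≡ , hi≡
  joins-unique {s} {t} (forwards refl refl) (backwards lo≡ hi≡) =
    contradiction (subst₂ (λ a b → toℕ a < toℕ b) lo≡ hi≡ (lo<hi t)) (<⇒≯ (lo<hi s))
  joins-unique {s} {t} (backwards refl refl) (forwards lo≡ hi≡) =
    contradiction (subst₂ (λ a b → toℕ a < toℕ b) lo≡ hi≡ (lo<hi t)) (<⇒≯ (lo<hi s))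
  joins-unique     (backwards refl refl) (backwards lo≡ hi≡) = lo≡ , hi≡

  joins-transport : ∀ {s t p q} → SameSlice σ t s → Joins t p q → Joins s p q
  joins-transport (lo≡ , hi≡) (forwards refl refl) = forwards (sym lo≡) (sym hi≡)
  joins-transport (lo≡ , hi≡) (backwards refl refl) = backwards (sym lo≡) (sym hi≡)

  adjacent-suc : ∀ k {p q} → coord σ k q ≡ suc (coord σ k p) → Adjacent σ k p q
  adjacent-suc k {p} q≡1+p = trans (cong (∣ coord σ k p -_∣) q≡1+p) (∣n-1+n∣≡1 (coord σ k p))

  joins-adjacent : ∀ k {s p q} → Joins s p q → HasType σ k s → Adjacent σ k p q
  joins-adjacent k (forwards refl refl) adj = adj
  joins-adjacent k (backwards refl refl) adj = adjacent-sym k adj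

  slice-joining : ∀ k {p q} → Adjacent σ k p q → ∃[ t ] (Joins t p q × HasType σ k t)
  slice-joining k {p} {q} adj with <-cmp (toℕ p) (toℕ q)
  ... | tri< p<q _ _ = slice p q p<q (k , adj) , forwards refl refl , adj
  ... | tri≈ _ p≡q _ = contradiction (subst (Adjacent σ k p) (sym (toℕ-injective p≡q)) adj) (adjacent-irrefl k)
  ... | tri> _ _ q<p = slice q p q<p (k , adjacent-sym k adj) , backwards refl refl , adjacent-sym k adj

  sorted-corners : ∀ k s → ∃₂ λ p q → Joins s p q × coord σ k p < coord σ k q
  sorted-corners k s with <-cmp (coord σ k (lo s)) (coord σ k (hi s))
  ... | tri< lo<hi′ _ _ = lo s , hi s , forwards refl refl , lo<hi′
  ... | tri≈ _ lo≡hi _  = contradiction (cong toℕ (coord-injective k lo≡hi)) (<⇒≢ (lo<hi s))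
  ... | tri> _ _ hi<lo′ = hi s , lo s , backwards refl refl , hi<lo′

  bounds-joins : ∀ k {s p q} → Joins s p q →
                 low σ k s ≡ coord σ k p ⊓ coord σ k q × high σ k s ≡ coord σ k p ⊔ coord σ k q
  bounds-joins k (forwards refl refl) = refl , refl
  bounds-joins k {s} (backwards refl refl) =
    ⊓-comm (coord σ k (lo s)) (coord σ k (hi s)) , ⊔-comm (coord σ k (lo s)) (coord σ k (hi s))

  bounds-sorted : ∀ k {s p q} → Joins s p q → coord σ k p < coord σ k q →
                  low σ k s ≡ coord σ k p × high σ k s ≡ coord σ k q
  bounds-sorted k s-pq p<q with bounds-joins k s-pq
  ... | low≡ , high≡ = trans low≡ (m≤n⇒m⊓n≡m (<⇒≤ p<q)) , trans high≡ (m≤n⇒m⊔n≡n (<⇒≤ p<q))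

  overlapOn⇔ : ∀ k {s t a b c d} → low σ k s ≡ a × high σ k s ≡ b → low σ k t ≡ c × high σ k t ≡ d →
               OverlapOn σ k s t ⇔ (a < d × c < b)
  overlapOn⇔ k (refl , refl) (refl , refl) = mk⇔ id id

  self-intersect : ∀ s → Intersect σ s s
  self-intersect s k = low<high , low<high
    where
    low<high : low σ k s < high σ k s
    low<high = m≢n⇒m⊓n<m⊔n (λ lo≡hi → <⇒≢ (lo<hi s) (cong toℕ (coord-injective k lo≡hi)))

  intersect-same-type : ∀ k {s t} → HasType σ k s → HasType σ k t → Intersect σ s t → SameSlice σ t s
  intersect-same-type k {s} {t} s-type t-type s∩t
    with sorted-corners k s | sorted-corners k t
  ... | p , q , s-pq , p<q | p′ , q′ , t-pq , p′<q′ =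
    joins-unique s-pq (subst₂ (Joins t) p′≡p q′≡q t-pq)
    where
    q≡1+p : coord σ k q ≡ suc (coord σ k p)
    q≡1+p = m<n∧∣m-n∣≡1⇒n≡1+m p<q (joins-adjacent k s-pq s-type)
    q′≡1+p′ : coord σ k q′ ≡ suc (coord σ k p′)
    q′≡1+p′ = m<n∧∣m-n∣≡1⇒n≡1+m p′<q′ (joins-adjacent k t-pq t-type)
    overlap-k : coord σ k p < coord σ k q′ × coord σ k p′ < coord σ k q
    overlap-k = Equivalence.to (overlapOn⇔ k {s} {t} (bounds-sorted k s-pq p<q) (bounds-sorted k t-pq p′<q′))
                               (s∩t k)
    p≡p′ : coord σ k p′ ≡ coord σ k p
    p≡p′ = ≤-antisym (s≤s⁻¹ (subst (coord σ k p′ <_) q≡1+p (proj₂ overlap-k)))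
                     (s≤s⁻¹ (subst (coord σ k p <_) q′≡1+p′ (proj₁ overlap-k)))
    p′≡p : p′ ≡ p
    p′≡p = coord-injective k p≡p′
    q′≡q : q′ ≡ q
    q′≡q = coord-injective k (trans q′≡1+p′ (trans (cong suc p≡p′) (sym q≡1+p)))

  orient : Fin n → Fin n → Fin 2 → Sign
  orient p q k = sign (coord σ k q ⊖ coord σ k p)

  orient-< : ∀ k {p q} → coord σ k p < coord σ k q → orient p q k ≡ Sign.+
  orient-< k p<q = cong sign (⊖-≥ (<⇒≤ p<q))

  orient-> : ∀ k {p q} → coord σ k q < coord σ k p → orient p q k ≡ Sign.-
  orient-> k = sign-⊖-<

  orient-swap : ∀ k {p q} → p ≢ q → orient q p k ≡ opposite (orient p q k)
  orient-swap k {p} {q} p≢q with <-cmp (coord σ k p) (coord σ k q)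
  ... | tri< p<q _ _ = trans (orient-> k p<q) (cong opposite (sym (orient-< k p<q)))
  ... | tri≈ _ p≡q _ = contradiction (coord-injective k p≡q) p≢q
  ... | tri> _ _ q<p = trans (orient-< k q<p) (cong opposite (sym (orient-> k q<p)))

  direction-joins : ∀ {s p q} → Joins s p q → ∀ k → direction σ s k ≡ orient p q zero * orient p q k
  direction-joins {s} (forwards refl refl) k = cong (_* orient (lo s) (hi s) k) (sym (orient-< zero (lo<hi s)))
  direction-joins {s} (backwards refl refl) k = begin
    orient (lo s) (hi s) k
      ≡⟨ orient-swap k (<⇒≢ (lo<hi s) ∘ cong toℕ ∘ sym) ⟩
    opposite (orient (hi s) (lo s) k)
      ≡⟨ cong (_* orient (hi s) (lo s) k) (orient-> zero (lo<hi s)) ⟨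
    orient (hi s) (lo s) zero * orient (hi s) (lo s) k
      ∎
    where open ≡-Reasoning

  SameDirection : Slice σ → Slice σ → Set
  SameDirection s t = ∀ k → direction σ s k ≡ direction σ t k

  direction-≡ : ∀ {s t p q x y} → Joins s p q → Joins t x y → (∀ k → orient p q k ≡ orient x y k) →
                SameDirection s t
  direction-≡ s-pq t-xy orient≡ k =
    trans (direction-joins s-pq k) (trans (cong₂ _*_ (orient≡ zero) (orient≡ k)) (sym (direction-joins t-xy k)))

  UniqueIntersecting : Fin 2 → Slice σ → Slice σ → Set
  UniqueIntersecting k s t =
    HasType σ k t × Intersect σ s t × (∀ t′ → HasType σ k t′ → Intersect σ s t′ → SameSlice σ t′ t)

  module Crossing (j : Fin 2) {s : Slice σ} (s-type : HasType σ j s)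
                  {ℓ u : Fin n} (s-ℓu : Joins s ℓ u) (ℓ<u : coord σ (other j) ℓ < coord σ (other j) u) where

    k : Fin 2
    k = other j

    m : ℕ
    m = low σ j s

    below : Fin n → Bool
    below x = does (coord σ j x ≤? m)

    SideOfℓ : Fin n → Set
    SideOfℓ x = below x ≡ below ℓ

    sideOfℓ? : Decidable SideOfℓ
    sideOfℓ? x = below x ≟ᵇ below ℓ

    InBand : Fin n → Set
    InBand x = coord σ k ℓ ≤ coord σ k x × coord σ k x ≤ coord σ k u

    record CrossingPair (x y : Fin n) : Set where
      constructor crossing
      field
        x-side   : SideOfℓ x
        ¬y-side  : ¬ SideOfℓ y
        x-band   : InBand x
        y-band   : InBand y
        adjacent : Adjacent σ k x y

    NoInversion : Set
    NoInversion = ∀ {x y} → SideOfℓ x → ¬ SideOfℓ y →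
                  coord σ k ℓ < coord σ k y → coord σ k y < coord σ k x → coord σ k x < coord σ k u → ⊥

    below-true : ∀ {z} → coord σ j z ≤ m → below z ≡ true
    below-true z≤m = dec-true (_ ≤? m) z≤m

    below-false : ∀ {z} → m < coord σ j z → below z ≡ false
    below-false m<z = dec-false (_ ≤? m) (<⇒≱ m<z)

    below-differ⇔ : ∀ {x y} →
                    below x ≢ below y ⇔ ((coord σ j x ≤ m × m < coord σ j y) ⊎ (coord σ j y ≤ m × m < coord σ j x))
    below-differ⇔ {x} {y} = mk⇔ to from
      where
      to : below x ≢ below y → (coord σ j x ≤ m × m < coord σ j y) ⊎ (coord σ j y ≤ m × m < coord σ j x)
      to differ with coord σ j x ≤? m | coord σ j y ≤? m
      ... | yes x≤m | no y≰m  = inj₁ (x≤m , ≰⇒> y≰m)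
      ... | no x≰m  | yes y≤m = inj₂ (y≤m , ≰⇒> x≰m)
      ... | yes x≤m | yes y≤m = contradiction (trans (below-true x≤m) (sym (below-true y≤m))) differ
      ... | no x≰m  | no y≰m  = contradiction (trans (below-false (≰⇒> x≰m)) (sym (below-false (≰⇒> y≰m)))) differ
      from : (coord σ j x ≤ m × m < coord σ j y) ⊎ (coord σ j y ≤ m × m < coord σ j x) → below x ≢ below y
      from (inj₁ (x≤m , m<y)) eq with trans (sym (below-true x≤m)) (trans eq (below-false m<y))
      ... | ()
      from (inj₂ (y≤m , m<x)) eq with trans (sym (below-true y≤m)) (trans (sym eq) (below-false m<x))
      ... | ()

    overlapOn-j⇔ : ∀ {t x y} → Joins t x y → OverlapOn σ j s t ⇔ (below x ≢ below y)
    overlapOn-j⇔ {t} t-xy =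
      ⇔-trans (overlapOn⇔ j {s} {t} (refl , ∣m-n∣≡1⇒m⊔n≡1+m⊓n s-type) (bounds-joins j t-xy))
              (⇔-trans straddle⇔ (⇔-sym below-differ⇔))

    overlapOn-k⇔ : ∀ {t x y} → Joins t x y → Adjacent σ k x y → OverlapOn σ k s t ⇔ (InBand x × InBand y)
    overlapOn-k⇔ {t} t-xy xy-adj =
      ⇔-trans (overlapOn⇔ k {s} {t} (bounds-sorted k s-ℓu ℓ<u) (bounds-joins k t-xy))
              (unit-overlap⇔ xy-adj)

    intersect⇔ : ∀ {t x y} → Joins t x y → Adjacent σ k x y →
                 Intersect σ s t ⇔ (below x ≢ below y × InBand x × InBand y)
    intersect⇔ {t} {x} {y} t-xy xy-adj = mk⇔ to from
      where
      to : Intersect σ s t → below x ≢ below y × InBand x × InBand y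
      to s∩t = Equivalence.to (overlapOn-j⇔ t-xy) (s∩t j) , Equivalence.to (overlapOn-k⇔ t-xy xy-adj) (s∩t k)
      from : below x ≢ below y × InBand x × InBand y → Intersect σ s t
      from (differ , bands) k′ with this-or-other j k′
      ... | inj₁ refl = Equivalence.from (overlapOn-j⇔ t-xy) differ
      ... | inj₂ refl = Equivalence.from (overlapOn-k⇔ t-xy xy-adj) bands

    ¬SideOfℓ-u : ¬ SideOfℓ u
    ¬SideOfℓ-u u-side = Equivalence.to (overlapOn-j⇔ s-ℓu) (self-intersect s j) (sym u-side)

    Separated : Fin n → Fin n → Set
    Separated x y = (coord σ j x ≤ coord σ j ℓ × coord σ j ℓ < coord σ j u × coord σ j u ≤ coord σ j y) ⊎
                    (coord σ j y ≤ coord σ j u × coord σ j u < coord σ j ℓ × coord σ j ℓ ≤ coord σ j x)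

    sides⇔ : ∀ {x y} → (SideOfℓ x × ¬ SideOfℓ y) ⇔ Separated x y
    sides⇔ {x} {y} = mk⇔ to from
      where
      ℓu-adjacent : Adjacent σ j ℓ u
      ℓu-adjacent = joins-adjacent j s-ℓu s-type
      to : SideOfℓ x × ¬ SideOfℓ y → Separated x y
      to (x-side , ¬y-side)
        with Equivalence.to below-differ⇔ (¬SideOfℓ-u ∘ sym)
           | Equivalence.to below-differ⇔ (λ x≡y → ¬y-side (trans (sym x≡y) x-side))
      ... | inj₁ (ℓ≤m , m<u) | inj₁ (x≤m , m<y) =
        let ℓ<u′ = ≤-<-trans ℓ≤m m<u
            x≤ℓ , u≤y = adjacent-straddle ℓ≤m m<u (m<n∧∣m-n∣≡1⇒n≡1+m ℓ<u′ ℓu-adjacent) x≤m m<y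
        in  inj₁ (x≤ℓ , ℓ<u′ , u≤y)
      ... | inj₂ (u≤m , m<ℓ) | inj₂ (y≤m , m<x) =
        let u<ℓ = ≤-<-trans u≤m m<ℓ
            y≤u , ℓ≤x = adjacent-straddle u≤m m<ℓ (m<n∧∣m-n∣≡1⇒n≡1+m u<ℓ (adjacent-sym j ℓu-adjacent)) y≤m m<x
        in  inj₂ (y≤u , u<ℓ , ℓ≤x)
      ... | inj₁ (ℓ≤m , _) | inj₂ (_ , m<x) = ⊥-elim (Equivalence.from below-differ⇔ (inj₁ (ℓ≤m , m<x)) (sym x-side))
      ... | inj₂ (_ , m<ℓ) | inj₁ (x≤m , _) = ⊥-elim (Equivalence.from below-differ⇔ (inj₁ (x≤m , m<ℓ)) x-side)
      from : Separated x y → SideOfℓ x × ¬ SideOfℓ y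
      from (inj₁ (x≤ℓ , ℓ<u′ , u≤y)) with Equivalence.to below-differ⇔ (¬SideOfℓ-u ∘ sym)
      ... | inj₁ (ℓ≤m , m<u) =
        trans (below-true (≤-trans x≤ℓ ℓ≤m)) (sym (below-true ℓ≤m)) ,
        λ y-side → Equivalence.from below-differ⇔ (inj₁ (ℓ≤m , <-≤-trans m<u u≤y)) (sym y-side)
      ... | inj₂ (u≤m , m<ℓ) = ⊥-elim (<-asym ℓ<u′ (≤-<-trans u≤m m<ℓ))
      from (inj₂ (y≤u , u<ℓ , ℓ≤x)) with Equivalence.to below-differ⇔ (¬SideOfℓ-u ∘ sym)
      ... | inj₂ (u≤m , m<ℓ) =
        trans (below-false (<-≤-trans m<ℓ ℓ≤x)) (sym (below-false m<ℓ)) ,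
        λ y-side → Equivalence.from below-differ⇔ (inj₁ (≤-trans y≤u u≤m , m<ℓ)) y-side
      ... | inj₁ (ℓ≤m , m<u) = ⊥-elim (<-asym u<ℓ (≤-<-trans ℓ≤m m<u))

    crossing-direction : ∀ {t x y} → Joins t x y → SideOfℓ x → ¬ SideOfℓ y → coord σ k x < coord σ k y →
                         SameDirection s t
    crossing-direction {x = x} {y} t-xy x-side ¬y-side x<y = direction-≡ s-ℓu t-xy orient≡
      where
      orient≡ : ∀ k′ → orient ℓ u k′ ≡ orient x y k′
      orient≡ k′ with this-or-other j k′ | Equivalence.to sides⇔ (x-side , ¬y-side)
      ... | inj₂ refl | _ = trans (orient-< k ℓ<u) (sym (orient-< k x<y))
      ... | inj₁ refl | inj₁ (x≤ℓ , ℓ<u′ , u≤y) =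
        trans (orient-< j ℓ<u′) (sym (orient-< j (≤-<-trans x≤ℓ (<-≤-trans ℓ<u′ u≤y))))
      ... | inj₁ refl | inj₂ (y≤u , u<ℓ , ℓ≤x) =
        trans (orient-> j u<ℓ) (sym (orient-> j (≤-<-trans y≤u (<-≤-trans u<ℓ ℓ≤x))))

    crossing-exists : ∃₂ λ x y → CrossingPair x y × coord σ k y ≡ suc (coord σ k x)
    crossing-exists =
      let x , y , x-side , ¬y-side , ℓ≤x , y≤u , y≡1+x = switch-along k sideOfℓ? (<⇒≤ ℓ<u) refl ¬SideOfℓ-u
          x<y = ≤-reflexive (sym y≡1+x)
      in  x , y , crossing x-side ¬y-side (ℓ≤x , <⇒≤ (<-≤-trans x<y y≤u)) (≤-trans ℓ≤x (<⇒≤ x<y) , y≤u)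
                           (adjacent-suc k y≡1+x) ,
          y≡1+x

    crossing⇒intersect : ∀ {t x y} → Joins t x y → CrossingPair x y → Intersect σ s t
    crossing⇒intersect t-xy (crossing x-side ¬y-side x-band y-band xy-adj) =
      Equivalence.from (intersect⇔ t-xy xy-adj) ((λ x≡y → ¬y-side (trans (sym x≡y) x-side)) , x-band , y-band)

    intersect⇒crossing : ∀ {t} → HasType σ k t → Intersect σ s t → ∃₂ λ x y → Joins t x y × CrossingPair x y
    intersect⇒crossing {t} t-type s∩t with Equivalence.to (intersect⇔ (forwards {t} refl refl) t-type) s∩t
    ... | differ , lo-band , hi-band with sideOfℓ? (lo t)
    ...   | yes lo-side =
      lo t , hi t , forwards refl refl ,
      crossing lo-side (λ hi-side → differ (trans lo-side (sym hi-side))) lo-band hi-band t-type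
    ...   | no ¬lo-side =
      hi t , lo t , backwards refl refl , crossing hi-side ¬lo-side hi-band lo-band (adjacent-sym k t-type)
      where
      hi-side : SideOfℓ (hi t)
      hi-side = trans (¬-not (differ ∘ sym)) (sym (¬-not (¬lo-side ∘ sym)))

    module _ (no-inversion : NoInversion) where

      side-before : ∀ {x y} → SideOfℓ x → ¬ SideOfℓ y → InBand x → InBand y → coord σ k x < coord σ k y
      side-before {x} {y} x-side ¬y-side (_ , x≤u) (ℓ≤y , _) with <-cmp (coord σ k x) (coord σ k y)
      ... | tri< x<y _ _ = x<y
      ... | tri≈ _ x≡y _ = contradiction (subst SideOfℓ (coord-injective k x≡y) x-side) ¬y-side
      ... | tri> _ _ y<x =
        ⊥-elim (no-inversion x-side ¬y-side (coord-≤∧≢⇒< k ℓ≤y ℓ≢y) y<x (coord-≤∧≢⇒< k x≤u x≢u))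
        where
        ℓ≢y : ℓ ≢ y
        ℓ≢y refl = ¬y-side refl
        x≢u : x ≢ u
        x≢u refl = ¬SideOfℓ-u x-side

      crossing-unique : ∀ {x y x′ y′} → CrossingPair x y → CrossingPair x′ y′ → x′ ≡ x × y′ ≡ y
      crossing-unique {x} {y} {x′} {y′} (crossing x-side ¬y-side x-band y-band xy-adj)
                      (crossing x′-side ¬y′-side x′-band y′-band x′y′-adj) =
        coord-injective k x′≡x , coord-injective k (trans y′≡1+x′ (trans (cong suc x′≡x) (sym y≡1+x)))
        where
        y≡1+x : coord σ k y ≡ suc (coord σ k x)
        y≡1+x = m<n∧∣m-n∣≡1⇒n≡1+m (side-before x-side ¬y-side x-band y-band) xy-adj
        y′≡1+x′ : coord σ k y′ ≡ suc (coord σ k x′)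
        y′≡1+x′ = m<n∧∣m-n∣≡1⇒n≡1+m (side-before x′-side ¬y′-side x′-band y′-band) x′y′-adj
        x′≡x : coord σ k x′ ≡ coord σ k x
        x′≡x = ≤-antisym (s≤s⁻¹ (subst (_ <_) y≡1+x (side-before x′-side ¬y-side x′-band y-band)))
                         (s≤s⁻¹ (subst (_ <_) y′≡1+x′ (side-before x-side ¬y′-side x-band y′-band)))

      unique-intersecting : ∃[ t ] (UniqueIntersecting k s t × SameDirection s t)
      unique-intersecting =
        let x , y , pair , y≡1+x = crossing-exists
            t , t-xy , t-type = slice-joining k (CrossingPair.adjacent pair)
        in  t , (t-type , crossing⇒intersect t-xy pair , only-t t-xy pair) ,
            crossing-direction t-xy (CrossingPair.x-side pair) (CrossingPair.¬y-side pair)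
                               (≤-reflexive (sym y≡1+x))
        where
        only-t : ∀ {t x y} → Joins t x y → CrossingPair x y →
                 ∀ t′ → HasType σ k t′ → Intersect σ s t′ → SameSlice σ t′ t
        only-t t-xy pair t′ t′-type s∩t′ =
          let x′ , y′ , t′-x′y′ , pair′ = intersect⇒crossing t′-type s∩t′
              x′≡x , y′≡y = crossing-unique pair pair′
          in  joins-unique t-xy (subst₂ (Joins t′) x′≡x y′≡y t′-x′y′)

    opposite-crossings : ∀ {t x₁ y₁ x₂ y₂} → Joins t x₁ y₁ → Joins t x₂ y₂ →
                         CrossingPair x₁ y₁ → CrossingPair x₂ y₂ →
                         coord σ k y₁ ≡ suc (coord σ k x₁) → coord σ k x₂ ≡ suc (coord σ k y₂) → ⊥
    opposite-crossings t-x₁y₁ t-x₂y₂ pair₁ pair₂ y₁≡1+x₁ x₂≡1+y₂ with joins-corners t-x₁y₁ t-x₂y₂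
    ... | inj₁ (refl , refl) = <-asym (≤-reflexive (sym y₁≡1+x₁)) (≤-reflexive (sym x₂≡1+y₂))
    ... | inj₂ (refl , refl) = CrossingPair.¬y-side pair₁ (CrossingPair.x-side pair₂)

    unique⇒no-inversion : ∀ {t₀} → UniqueIntersecting k s t₀ → NoInversion
    unique⇒no-inversion {t₀} (_ , _ , only-t₀) {x} {y} x-side ¬y-side ℓ<y y<x x<u
      with crossing-exists | switch-along k (¬? ∘ sideOfℓ?) (<⇒≤ y<x) ¬y-side (_$ x-side)
    ... | x₁ , y₁ , pair₁ , y₁≡1+x₁ | y₂ , x₂ , ¬y₂-side , ¬¬x₂-side , y≤y₂ , x₂≤x , x₂≡1+y₂ =
      opposite-crossings (joins-t₀ pair₁) (joins-t₀ pair₂) pair₁ pair₂ y₁≡1+x₁ x₂≡1+y₂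
      where
      joins-t₀ : ∀ {p q} → CrossingPair p q → Joins t₀ p q
      joins-t₀ pair =
        let t , t-pq , t-type = slice-joining k (CrossingPair.adjacent pair)
        in  joins-transport (only-t₀ t t-type (crossing⇒intersect t-pq pair)) t-pq
      y₂<x₂ : coord σ k y₂ < coord σ k x₂
      y₂<x₂ = ≤-reflexive (sym x₂≡1+y₂)
      x₂≤u : coord σ k x₂ ≤ coord σ k u
      x₂≤u = ≤-trans x₂≤x (<⇒≤ x<u)
      ℓ≤y₂ : coord σ k ℓ ≤ coord σ k y₂
      ℓ≤y₂ = ≤-trans (<⇒≤ ℓ<y) y≤y₂
      pair₂ : CrossingPair x₂ y₂
      pair₂ = crossing (decidable-stable (sideOfℓ? x₂) ¬¬x₂-side) ¬y₂-side
                       (≤-trans ℓ≤y₂ (<⇒≤ y₂<x₂) , x₂≤u) (ℓ≤y₂ , ≤-trans (<⇒≤ y₂<x₂) x₂≤u)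
                       (adjacent-sym k (adjacent-suc k x₂≡1+y₂))

  baxter⇒no-inversion₀ : Baxter σ → ∀ {s ℓ u} (s-type : HasType σ zero s) (s-ℓu : Joins s ℓ u)
                          (ℓ<u : val σ ℓ < val σ u) → Crossing.NoInversion zero s-type s-ℓu ℓ<u
  baxter⇒no-inversion₀ baxter {ℓ = ℓ} {u} s-type s-ℓu ℓ<u {x} {y} x-side ¬y-side ℓ<y y<x x<u =
    case Equivalence.to (Crossing.sides⇔ zero s-type s-ℓu ℓ<u) (x-side , ¬y-side) of λ where
      (inj₁ (x≤ℓ , ℓ<u′ , u≤y)) →
        proj₂ (baxter x _ _ y (coord-≤∧≢⇒< zero x≤ℓ (≢-sym ℓ≢x))
                              (m<n∧∣m-n∣≡1⇒n≡1+m ℓ<u′ ℓu-adjacent)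
                              (coord-≤∧≢⇒< zero u≤y (≢-sym y≢u)))
              inversion
      (inj₂ (y≤u , u<ℓ , ℓ≤x)) →
        proj₁ (baxter y _ _ x (coord-≤∧≢⇒< zero y≤u y≢u)
                              (m<n∧∣m-n∣≡1⇒n≡1+m u<ℓ (adjacent-sym zero {ℓ} {u} ℓu-adjacent))
                              (coord-≤∧≢⇒< zero ℓ≤x ℓ≢x))
              inversion
    where
    ℓu-adjacent : Adjacent σ zero ℓ u
    ℓu-adjacent = joins-adjacent zero s-ℓu s-type
    inversion : val σ ℓ < val σ y × val σ y < val σ x × val σ x < val σ u
    inversion = ℓ<y , y<x , x<u
    ℓ≢x : ℓ ≢ x
    ℓ≢x = coord-<⇒≢ (suc zero) (<-trans ℓ<y y<x)
    y≢u : y ≢ u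
    y≢u = coord-<⇒≢ (suc zero) (<-trans y<x x<u)

  baxter⇒no-inversion₁ : Baxter σ → ∀ {s ℓ u} (s-type : HasType σ (suc zero) s) (s-ℓu : Joins s ℓ u)
                          (ℓ<u : toℕ ℓ < toℕ u) → Crossing.NoInversion (suc zero) s-type s-ℓu ℓ<u
  baxter⇒no-inversion₁ baxter {ℓ = ℓ} {u} s-type s-ℓu ℓ<u {x} {y} x-side ¬y-side ℓ<y y<x x<u =
    let a , b , ¬a-side , ¬¬b-side , y≤a , b≤x , b≡1+a =
          switch-along zero (¬? ∘ sideOfℓ?) (<⇒≤ y<x) ¬y-side (_$ x-side)
        ℓ<a = <-≤-trans ℓ<y y≤a
        b<u = ≤-<-trans b≤x x<u
        ℓ≢b = coord-<⇒≢ zero (<-trans ℓ<a (≤-reflexive (sym b≡1+a)))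
        a≢u = coord-<⇒≢ zero (<-trans (≤-reflexive (sym b≡1+a)) b<u)
    in  case Equivalence.to sides⇔ (decidable-stable (sideOfℓ? b) ¬¬b-side , ¬a-side) of λ where
          (inj₁ (b≤ℓ , ℓ<u′ , u≤a)) →
            proj₁ (baxter ℓ a b u ℓ<a b≡1+a b<u)
                  (coord-≤∧≢⇒< (suc zero) b≤ℓ (≢-sym ℓ≢b) , ℓ<u′ , coord-≤∧≢⇒< (suc zero) u≤a (≢-sym a≢u))
          (inj₂ (a≤u , u<ℓ , ℓ≤b)) →
            proj₂ (baxter ℓ a b u ℓ<a b≡1+a b<u)
                  (coord-≤∧≢⇒< (suc zero) a≤u a≢u , u<ℓ , coord-≤∧≢⇒< (suc zero) ℓ≤b ℓ≢b)
    where open Crossing (suc zero) s-type s-ℓu ℓ<u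

  baxter⇒no-inversion : Baxter σ → ∀ j {s ℓ u} (s-type : HasType σ j s) (s-ℓu : Joins s ℓ u)
                        (ℓ<u : coord σ (other j) ℓ < coord σ (other j) u) → Crossing.NoInversion j s-type s-ℓu ℓ<u
  baxter⇒no-inversion baxter zero       = baxter⇒no-inversion₀ baxter
  baxter⇒no-inversion baxter (suc zero) = baxter⇒no-inversion₁ baxter

  sameSlice⇒sameDirection : ∀ {s t} → SameSlice σ t s → SameDirection t s
  sameSlice⇒sameDirection (lo≡ , hi≡) k = cong₂ (λ p q → orient p q k) lo≡ hi≡

  baxter⇒unique-intersecting : Baxter σ → ∀ s k → ∃[ t ] (UniqueIntersecting k s t × SameDirection s t)
  baxter⇒unique-intersecting baxter s k with ∣ coord σ k (lo s) - coord σ k (hi s) ∣ ≟ 1 | adj s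
  ... | yes s-type | _ =
    s , (s-type , self-intersect s , λ t′ → intersect-same-type k {s} {t′} s-type) , λ _ → refl
  ... | no ¬s-type | j , s-type with this-or-other j k
  ...   | inj₁ refl = contradiction s-type ¬s-type
  ...   | inj₂ refl =
    let ℓ , u , s-ℓu , ℓ<u = sorted-corners (other j) s
    in  Crossing.unique-intersecting j s-type s-ℓu ℓ<u (baxter⇒no-inversion baxter j s-type s-ℓu ℓ<u)

  baxter⇒wellSliced : Baxter σ → WellSliced σ
  baxter⇒wellSliced baxter = unique , same-direction
    where
    unique : ∀ s k → ∃[ t ] UniqueIntersecting k s t
    unique s k = let t , unique-t , _ = baxter⇒unique-intersecting baxter s k in t , unique-t
    same-direction : ∀ s t → Intersect σ s t → SameDirection s t
    same-direction s t s∩t k′ with adj t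
    ... | k , t-type =
      let t₀ , (_ , _ , only-t₀) , s≡t₀-direction = baxter⇒unique-intersecting baxter s k
      in  trans (s≡t₀-direction k′) (sym (sameSlice⇒sameDirection {t₀} {t} (only-t₀ t t-type s∩t) k′))

  wellSliced⇒baxter : WellSliced σ → Baxter σ
  -- 2413 and 3142 are inversions for the slice (i₂ , i₃), with ℓ = i₃ and ℓ = i₂ respectively.
  wellSliced⇒baxter (unique , _) i₁ i₂ i₃ i₄ i₁<i₂ i₃≡1+i₂ i₃<i₄ =
    (λ (i₃<i₁ , i₁<i₄ , i₄<i₂) →
       no-inversion (backwards refl refl) (<-trans i₃<i₁ (<-trans i₁<i₄ i₄<i₂))
                    (inj₂ (<⇒≤ i₁<i₂ , i₂<i₃ , <⇒≤ i₃<i₄)) i₃<i₁ i₁<i₄ i₄<i₂) ,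
    (λ (i₂<i₄ , i₄<i₁ , i₁<i₃) →
       no-inversion (forwards refl refl) (<-trans i₂<i₄ (<-trans i₄<i₁ i₁<i₃))
                    (inj₁ (<⇒≤ i₁<i₂ , i₂<i₃ , <⇒≤ i₃<i₄)) i₂<i₄ i₄<i₁ i₁<i₃)
    where
    i₂<i₃ : toℕ i₂ < toℕ i₃
    i₂<i₃ = ≤-reflexive (sym i₃≡1+i₂)
    s-type : Adjacent σ zero i₂ i₃
    s-type = adjacent-suc zero i₃≡1+i₂
    s : Slice σ
    s = slice i₂ i₃ i₂<i₃ (zero , s-type)
    no-inversion : ∀ {ℓ u x y} (s-ℓu : Joins s ℓ u) (ℓ<u : val σ ℓ < val σ u) →
                   Crossing.Separated zero s-type s-ℓu ℓ<u x y →
                   val σ ℓ < val σ y → val σ y < val σ x → val σ x < val σ u → ⊥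
    no-inversion s-ℓu ℓ<u separated =
      let x-side , ¬y-side = Equivalence.from (Crossing.sides⇔ zero s-type s-ℓu ℓ<u) separated
          t₀ , unique-t₀ = unique s (suc zero)
      in  Crossing.unique⇒no-inversion zero s-type s-ℓu ℓ<u {t₀} unique-t₀ x-side ¬y-side

proposition5 : ∀ (n : ℕ) (σ : Permutation′ n) → Baxter σ ⇔ WellSliced σ
proposition5 n σ = mk⇔ (baxter⇒wellSliced σ) (wellSliced⇒baxter σ)
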